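{- Let $G$ be a graph, let $\mathsf{w}$ be a normal weighting of $G$, let $X, Y \subseteq V(G)$, and let $Z \subseteq X$. Suppose that $X \cup Y$ is a $\mathsf{w}$-balanced separator of $G$ but that $Z$ is not. Let $B$ be the heavy component of $G - Z$. Then $S := (N[B] \cap X) \cup Y$ is a $\mathsf{w}$-balanced separator of $G$.
   Context: All graphs are finite and simple. A weighting of $G$ is a function $\mathsf{w}\colon V(G) \to \mathbb{R}_{\geq 0}$; for $A \subseteq V(G)$ (or a subgraph $A$), $\mathsf{w}(A) = \sum_{v \in A}\mathsf{w}(v)$. The weighting is normal if $\mathsf{w}(V(G)) = 1$. A subgraph $H$ is heavy if $\mathsf{w}(H) > \frac12 \mathsf{w}(G)$. A set $S \subseteq V(G)$ is a $\mathsf{w}$-balanced separator of $G$ if no component of $G - S$ is heavy. For a normal weighting, if $Z$ is not a $\mathsf{w}$-balanced separator, then $G-Z$ has exactly one heavy component. $N[B]$ denotes the closed neighbourhood of $V(B)$.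
   Formalization: The weighting $\mathsf{w}$ takes nonnegative rational values rather than values in $\mathbb{R}_{\geq 0}$. -}

module Defs where

open import Data.Nat using (ℕ; zero; suc)
open import Data.Fin using (Fin; zero; suc)
open import Data.Bool using (Bool; true; false; if_then_else_; _∧_; _∨_)
open import Data.Rational using (ℚ; 0ℚ; 1ℚ; ½; _+_; _*_; _<_; _≤_)
open import Data.Product using (Σ; ∃; _×_)
open import Relation.Nullary using (¬_)
open import Relation.Binary.PropositionalEquality using (_≡_)

record Graph (n : ℕ) : Set where
  field
    adj    : Fin n → Fin n → Bool
    sym    : ∀ u v → adj u v ≡ adj v u
    irrefl : ∀ v → adj v v ≡ false
open Graph public

VSet : ℕ → Set
VSet n = Fin n → Bool

_∈_ : ∀ {n} → Fin n → VSet n → Set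
v ∈ A = A v ≡ true

_∉_ : ∀ {n} → Fin n → VSet n → Set
v ∉ A = ¬ (v ∈ A)

_⊆_ : ∀ {n} → VSet n → VSet n → Set
A ⊆ B = ∀ v → v ∈ A → v ∈ B

_∪_ : ∀ {n} → VSet n → VSet n → VSet n
(A ∪ B) v = A v ∨ B v

_∩_ : ∀ {n} → VSet n → VSet n → VSet n
(A ∩ B) v = A v ∧ B v

full : ∀ {n} → VSet n
full _ = true

anyFin : ∀ {n} → (Fin n → Bool) → Bool
anyFin {zero}  f = false
anyFin {suc n} f = f zero ∨ anyFin (λ i → f (suc i))

N[_] : ∀ {n} {G : Graph n} → VSet n → VSet n
N[_] {G = G} B v = B v ∨ anyFin (λ u → B u ∧ adj G u v)

sumFin : ∀ {n} → (Fin n → ℚ) → ℚ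
sumFin {zero}  f = 0ℚ
sumFin {suc n} f = f zero + sumFin (λ i → f (suc i))

Weighting : ℕ → Set
Weighting n = Fin n → ℚ

NonNeg : ∀ {n} → Weighting n → Set
NonNeg w = ∀ v → 0ℚ ≤ w v

wt : ∀ {n} → Weighting n → VSet n → ℚ
wt w A = sumFin (λ v → if A v then w v else 0ℚ)

Normal : ∀ {n} → Weighting n → Set
Normal w = wt w full ≡ 1ℚ

data Reach {n} (G : Graph n) (S : VSet n) : Fin n → Fin n → Set where
  here : ∀ {u} → u ∉ S → Reach G S u u
  step : ∀ {u x v} → u ∉ S → adj G u x ≡ true → Reach G S x v → Reach G S u v

IsComponent : ∀ {n} → Graph n → VSet n → VSet n → Set
IsComponent G S C =
  (∃ λ v → v ∈ C)
  × (∀ v → v ∈ C → v ∉ S)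
  × (∀ u v → u ∈ C → v ∈ C → Reach G S u v)
  × (∀ u v → u ∈ C → Reach G S u v → v ∈ C)

Heavy : ∀ {n} → Weighting n → VSet n → Set
Heavy w C = ½ * wt w full < wt w C

BalancedSep : ∀ {n} → Graph n → Weighting n → VSet n → Set
BalancedSep G w S = ∀ C → IsComponent G S C → ¬ Heavy w C

-- Two heavy vertex sets cannot be disjoint, so a heavy component C of G - S
-- meets B. A walk in G - S that starts in B cannot leave B: its first vertex
-- outside B would be a neighbour of B lying in Z ⊆ X, hence in S. So C ⊆ B, and
-- inside N[B] avoiding S is the same as avoiding X ∪ Y; thus C is also a
-- heavy component of G - (X ∪ Y), contradicting the balance of X ∪ Y.
module Submission where

open import Defs
open import Data.Nat using (ℕ)
open import Data.Fin using (Fin; zero; suc)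
open import Data.Bool using (Bool; true; false; if_then_else_; _∧_; _∨_)
open import Data.Rational using (ℚ; 0ℚ; 1ℚ; ½; _+_; _*_; _<_; _≤_)
import Data.Rational.Properties as ℚ
open import Data.Product using (_,_)
open import Data.Empty using (⊥; ⊥-elim)
open import Relation.Nullary using (¬_)
open import Relation.Binary.PropositionalEquality as ≡ using (_≡_; refl; subst)
open import Algebra.Bundles using (CommutativeMonoid)
open import Algebra.Properties.CommutativeSemigroup
  (CommutativeMonoid.commutativeSemigroup ℚ.+-0-commutativeMonoid) using (interchange)

∧-intro : ∀ {a b : Bool} → a ≡ true → b ≡ true → a ∧ b ≡ true
∧-intro refl refl = refl

∨-introˡ : ∀ {a b : Bool} → a ≡ true → a ∨ b ≡ true
∨-introˡ refl = refl

∨-introʳ : ∀ {a b : Bool} → b ≡ true → a ∨ b ≡ true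
∨-introʳ {true}  _    = refl
∨-introʳ {false} refl = refl

anyFin-intro : ∀ {n} (f : Fin n → Bool) (i : Fin n) → f i ≡ true → anyFin f ≡ true
anyFin-intro f zero    fi≡true = ∨-introˡ fi≡true
anyFin-intro f (suc i) fi≡true = ∨-introʳ (anyFin-intro (λ j → f (suc j)) i fi≡true)

∈-N[]-self : ∀ {n} {G : Graph n} (B : VSet n) → B ⊆ N[_] {G = G} B
∈-N[]-self B v = ∨-introˡ

∈-N[]-adj : ∀ {n} {G : Graph n} (B : VSet n) {u v : Fin n} →
  u ∈ B → adj G u v ≡ true → v ∈ N[_] {G = G} B
∈-N[]-adj {G = G} B {u} {v} u∈B uv =
  ∨-introʳ (anyFin-intro (λ x → B x ∧ adj G x v) u (∧-intro u∈B uv))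

∩-∪-⊆-∪ : ∀ {n} (N X Y : VSet n) → ((N ∩ X) ∪ Y) ⊆ (X ∪ Y)
∩-∪-⊆-∪ N X Y v h with N v | X v | Y v
... | _     | true  | _     = refl
... | _     | false | true  = refl
... | true  | false | false = h
... | false | false | false = h

∉-∩-∪⇒∉-∪ : ∀ {n} (N X Y : VSet n) {v : Fin n} →
  v ∈ N → v ∉ ((N ∩ X) ∪ Y) → v ∉ (X ∪ Y)
∉-∩-∪⇒∉-∪ N X Y {v} v∈N v∉S v∈X∪Y with N v | X v | Y v
∉-∩-∪⇒∉-∪ N X Y refl v∉S _  | true | true  | _     = v∉S refl
∉-∩-∪⇒∉-∪ N X Y refl v∉S _  | true | false | true  = v∉S refl
∉-∩-∪⇒∉-∪ N X Y refl v∉S () | true | false | false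

sumFin-+-≤ : ∀ {n} (f g h : Fin n → ℚ) → (∀ i → f i + g i ≤ h i) →
  sumFin f + sumFin g ≤ sumFin h
sumFin-+-≤ {ℕ.zero}  f g h fg≤h = ℚ.≤-refl
sumFin-+-≤ {ℕ.suc n} f g h fg≤h =
  subst (_≤ sumFin h)
    (≡.sym (interchange (f zero) (sumFin (λ i → f (suc i))) (g zero) (sumFin (λ i → g (suc i)))))
    (ℚ.+-mono-≤ (fg≤h zero)
      (sumFin-+-≤ (λ i → f (suc i)) (λ i → g (suc i)) (λ i → h (suc i)) (λ i → fg≤h (suc i))))

wt-disjoint-≤ : ∀ {n} (w : Weighting n) → NonNeg w → (A B : VSet n) →
  (∀ v → v ∈ A → v ∉ B) → wt w A + wt w B ≤ wt w full
wt-disjoint-≤ w w≥0 A B disjoint = sumFin-+-≤ _ _ _ (λ v → pointwise v (disjoint v))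
  where
  pointwise : ∀ v → (A v ≡ true → B v ≡ true → ⊥) →
    (if A v then w v else 0ℚ) + (if B v then w v else 0ℚ) ≤ w v
  pointwise v disjoint-at-v with A v | B v
  ... | true  | true  = ⊥-elim (disjoint-at-v refl refl)
  ... | true  | false = ℚ.≤-reflexive (ℚ.+-identityʳ (w v))
  ... | false | true  = ℚ.≤-reflexive (ℚ.+-identityˡ (w v))
  ... | false | false = w≥0 v

½*p+½*p≡p : ∀ p → ½ * p + ½ * p ≡ p
½*p+½*p≡p p = begin
  ½ * p + ½ * p ≡⟨ ℚ.*-distribʳ-+ p ½ ½ ⟨
  (½ + ½) * p   ≡⟨⟩
  1ℚ * p        ≡⟨ ℚ.*-identityˡ p ⟩
  p             ∎
  where open ≡.≡-Reasoning

heavy-sets-not-disjoint : ∀ {n} (w : Weighting n) → NonNeg w → (A B : VSet n) →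
  Heavy w A → Heavy w B → ¬ (∀ v → v ∈ A → v ∉ B)
heavy-sets-not-disjoint w w≥0 A B A-heavy B-heavy disjoint =
  ℚ.<-irrefl refl (ℚ.<-≤-trans total<A+B (wt-disjoint-≤ w w≥0 A B disjoint))
  where
  total<A+B : wt w full < wt w A + wt w B
  total<A+B = subst (_< wt w A + wt w B) (½*p+½*p≡p (wt w full)) (ℚ.+-mono-< A-heavy B-heavy)

Reach-head-∉ : ∀ {n} {G : Graph n} {S : VSet n} {u v : Fin n} → Reach G S u v → u ∉ S
Reach-head-∉ (here u∉S)     = u∉S
Reach-head-∉ (step u∉S _ _) = u∉S

Reach-antimono : ∀ {n} {G : Graph n} {S T : VSet n} → S ⊆ T →
  ∀ {u v} → Reach G T u v → Reach G S u v
Reach-antimono S⊆T (here u∉T)          = here (λ u∈S → u∉T (S⊆T _ u∈S))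
Reach-antimono S⊆T (step u∉T uv reach) = step (λ u∈S → u∉T (S⊆T _ u∈S)) uv (Reach-antimono S⊆T reach)

Reach-from-component-lift : ∀ {n} {G : Graph n} {S T C : VSet n} →
  IsComponent G S C → (∀ v → v ∈ C → v ∉ T) →
  ∀ {u v} → u ∈ C → Reach G S u v → Reach G T u v
Reach-from-component-lift C-comp C∩T=∅ u∈C (here _) = here (C∩T=∅ _ u∈C)
Reach-from-component-lift {C = C} C-comp@(_ , _ , _ , closed) C∩T=∅ {u} u∈C
  (step {x = x} u∉S ux reach) =
  step (C∩T=∅ u u∈C) ux (Reach-from-component-lift C-comp C∩T=∅ x∈C reach)
  where
  x∈C : x ∈ C
  x∈C = closed u x u∈C (step u∉S ux (here (Reach-head-∉ reach)))

IsComponent-enlarge : ∀ {n} {G : Graph n} {S T C : VSet n} → S ⊆ T →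
  (∀ v → v ∈ C → v ∉ T) → IsComponent G S C → IsComponent G T C
IsComponent-enlarge S⊆T C∩T=∅ C-comp@(nonempty , _ , connected , closed) =
  nonempty ,
  C∩T=∅ ,
  (λ u v u∈C v∈C → Reach-from-component-lift C-comp C∩T=∅ u∈C (connected u v u∈C v∈C)) ,
  (λ u v u∈C reach → closed u v u∈C (Reach-antimono S⊆T reach))

Reach-from-component-stays : ∀ {n} {G : Graph n} {Z S B : VSet n} →
  IsComponent G Z B → (∀ v → v ∈ N[_] {G = G} B → v ∈ Z → v ∈ S) →
  ∀ {u v} → u ∈ B → Reach G S u v → v ∈ B
Reach-from-component-stays B-comp N[B]∩Z⊆S u∈B (here _) = u∈B
Reach-from-component-stays {G = G} {Z = Z} {B = B} B-comp@(_ , B∩Z=∅ , _ , closed) N[B]∩Z⊆S {u} u∈B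
  (step {x = x} _ ux reach) =
  Reach-from-component-stays B-comp N[B]∩Z⊆S x∈B reach
  where
  x∉Z : x ∉ Z
  x∉Z x∈Z = Reach-head-∉ reach (N[B]∩Z⊆S x (∈-N[]-adj {G = G} B u∈B ux) x∈Z)
  x∈B : x ∈ B
  x∈B = closed u x u∈B (step (B∩Z=∅ u u∈B) ux (here x∉Z))

lemma3p1 : ∀ {n} (G : Graph n) (w : Weighting n) → NonNeg w → Normal w →
    (X Y Z : VSet n) → Z ⊆ X →
    BalancedSep G w (X ∪ Y) → ¬ BalancedSep G w Z →
    (B : VSet n) → IsComponent G Z B → Heavy w B →
    BalancedSep G w ((N[_] {G = G} B ∩ X) ∪ Y)
lemma3p1 {n} G w w≥0 _ X Y Z Z⊆X X∪Y-balanced _ B B-comp B-heavy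
  C C-comp@(_ , C∩S=∅ , C-connected , _) C-heavy =
  heavy-sets-not-disjoint w w≥0 B C B-heavy C-heavy B∩C=∅
  where
  N[B] : VSet n
  N[B] = N[_] {G = G} B

  N[B]∩Z⊆S : ∀ v → v ∈ N[B] → v ∈ Z → v ∈ ((N[B] ∩ X) ∪ Y)
  N[B]∩Z⊆S v v∈N[B] v∈Z = ∨-introˡ (∧-intro v∈N[B] (Z⊆X v v∈Z))

  B∩C=∅ : ∀ v → v ∈ B → v ∉ C
  B∩C=∅ v v∈B v∈C = X∪Y-balanced C (IsComponent-enlarge (∩-∪-⊆-∪ N[B] X Y) C∩X∪Y=∅ C-comp) C-heavy
    where
    C⊆B : C ⊆ B
    C⊆B u u∈C = Reach-from-component-stays B-comp N[B]∩Z⊆S v∈B (C-connected v u v∈C u∈C)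
    C∩X∪Y=∅ : ∀ u → u ∈ C → u ∉ (X ∪ Y)
    C∩X∪Y=∅ u u∈C = ∉-∩-∪⇒∉-∪ N[B] X Y (∈-N[]-self {G = G} B u (C⊆B u u∈C)) (C∩S=∅ u u∈C)
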